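{- Let $G$ be a finite connected undirected graph (loops and multiple edges allowed) labeled by an $\mathcal{AL}$ labeling $\langle r,d_1,d_2\rangle$, with black layers $BL_0,BL_1,\dots,BL_{D_B}$ listed in increasing distance from $r$. Let $u$ be a white node and suppose $d(r,BL_i)<d(r,u)<d(r,BL_{i+1})$ for some $i$. Then $R_W(u)\le d(BL_i,BL_{i+1})-2$.
   Context: $d(u,v)$ is graph distance. $L_j$ denotes the set of nodes at distance $j$ from $r$. $\mathcal{AL}$ labeling $\langle r,d_1,d_2\rangle$: $r$ is a node, $d_1\ge2$ and $d_2$ are integers with $\lfloor d_2/2\rfloor\ge d_1$; a node $v$ is black iff $d(r,v)\bmod(d_1+d_2+2)\in\{0,1,d_2+1,d_1+d_2+1\}$, white otherwise. A black layer is a nonempty layer $L_j$ whose nodes are black; the black layers are $BL_0=L_0,BL_1,\dots,BL_{D_B}$ with $d(r,BL_i)<d(r,BL_j)$ for $i<j$. For a layer $L$, $d(r,L)$ is the distance from $r$ to any node of $L$, and $d(L,L')=|d(r,L)-d(r,L')|$. White radius: if the nearest black nodes to a node $v$ are at distance $\ell$, then $R_W(v)=\ell-1$. -}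

module Defs where

open import Data.Nat using (ℕ; zero; suc; _+_; _∸_; _≤_; _<_; _%_; _/_)
open import Data.Fin using (Fin)
open import Data.Product using (Σ; ∃; _×_; _,_)
open import Data.Sum using (_⊎_)
open import Relation.Binary.PropositionalEquality using (_≡_)
open import Relation.Nullary using (¬_)
open import Data.Empty using (⊥)

-- Loops and multiple edges
-- are allowed; since only graph distance matters, the multigraph is
-- represented by its (symmetric, possibly reflexive) adjacency relation.
record Graph : Set₁ where
  field
    n    : ℕ
    Adj  : Fin n → Fin n → Set
    sym  : ∀ {u v} → Adj u v → Adj v u

module _ (G : Graph) where
  open Graph G

  data Walk : Fin n → Fin n → ℕ → Set where
    here : ∀ {u} → Walk u u 0
    step : ∀ {u w v k} → Adj u w → Walk w v k → Walk u v (suc k)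

  Connected : Set
  Connected = ∀ u v → ∃ λ k → Walk u v k

  Dist : Fin n → Fin n → ℕ → Set
  Dist u v k = Walk u v k × (∀ m → Walk u v m → k ≤ m)

  module AL (r : Fin n) (d₁ d₂ : ℕ) where

    period : ℕ
    period = suc (suc (d₁ + d₂))

    BlackIndex : ℕ → Set
    BlackIndex j = (j % period ≡ 0) ⊎ (j % period ≡ 1)
                 ⊎ (j % period ≡ suc d₂) ⊎ (j % period ≡ suc (d₁ + d₂))

    Black : Fin n → Set
    Black v = ∃ λ j → Dist r v j × BlackIndex j

    White : Fin n → Set
    White v = ¬ Black v

    BlackLayer : ℕ → Set
    BlackLayer j = BlackIndex j × (∃ λ v → Dist r v j)

    NearestBlackDist : Fin n → ℕ → Set
    NearestBlackDist v ℓ =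
      (∃ λ w → Black w × Dist v w ℓ) ×
      (∀ w m → Black w → Dist v w m → ℓ ≤ m)

    WhiteRadius : Fin n → ℕ → Set
    WhiteRadius v ρ = ∃ λ ℓ → NearestBlackDist v ℓ × ρ ≡ ℓ ∸ 1

    -- L_a and L_b are consecutive black layers (BL_i and BL_{i+1}).
    ConsecutiveBlackLayers : ℕ → ℕ → Set
    ConsecutiveBlackLayers a b =
      BlackLayer a × BlackLayer b × a < b ×
      (∀ j → BlackLayer j → a < j → j < b → ⊥)

module Submission where

-- Let u be white with d(r,BL_i) = a < d(r,u) = du < d(r,BL_{i+1}) = b.
-- Cut a shortest walk from r to u after its first a steps, at a node w.
-- Both pieces of a shortest walk are themselves shortest, so d(r,w) = a and
-- d(w,u) = du - a.  Since L_a is a black layer, w is black; hence the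
-- nearest black node to u is at distance ℓ ≤ du - a < b - a, and therefore
-- R_W(u) = ℓ - 1 ≤ (b - a) - 2.

open import Defs
open import Data.Nat using (ℕ; zero; suc; _+_; _∸_; _≤_; _<_; _/_; z≤n; s≤s)
open import Data.Nat.Properties
  using (≤-trans; <⇒≤; +-cancelˡ-≤; +-cancelʳ-≤; m+[n∸m]≡n; ∸-monoˡ-≤; ∸-monoˡ-<)
open import Data.Fin using (Fin)
open import Data.Product using (∃; _×_; _,_)
open import Relation.Binary.PropositionalEquality using (_≡_; refl; subst; sym)

module Walks (G : Graph) where
  open Graph G using (Adj) renaming (sym to adjSym)

  _++_ : ∀ {u w v m k} → Walk G u w m → Walk G w v k → Walk G u v (m + k)
  here     ++ q = q
  step e p ++ q = step e (p ++ q)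

  _▷_ : ∀ {u v x k} → Walk G u v k → Adj v x → Walk G u x (suc k)
  here       ▷ e = step e here
  step e′ p  ▷ e = step e′ (p ▷ e)

  reverse : ∀ {u v k} → Walk G u v k → Walk G v u k
  reverse here       = here
  reverse (step e p) = reverse p ▷ adjSym e

  splitAt : ∀ {u v} a c → Walk G u v (a + c) →
            ∃ λ w → Walk G u w a × Walk G w v c
  splitAt zero    c p          = _ , here , p
  splitAt (suc a) c (step e p) with splitAt a c p
  ... | w , front , back = w , step e front , back

  reverseDist : ∀ {u v k} → Dist G u v k → Dist G v u k
  reverseDist (p , shortest) = reverse p , λ m q → shortest m (reverse q)

  -- Both pieces of a shortest walk cut after a steps are shortest walks:
  -- a shorter replacement of either piece would shorten the whole walk.
  splitDist : ∀ {u v} a c → Dist G u v (a + c) →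
              ∃ λ w → Dist G u w a × Dist G w v c
  splitDist a c (p , shortest) with splitAt a c p
  ... | w , front , back =
    w , (front , λ m q → +-cancelʳ-≤ c a m (shortest (m + c) (q ++ back)))
      , (back  , λ m q → +-cancelˡ-≤ a c m (shortest (a + m) (front ++ q)))

pred-<-∸2 : ∀ {x y} → x < y → x ∸ 1 ≤ y ∸ 2
pred-<-∸2 {zero}  _         = z≤n
pred-<-∸2 {suc x} (s≤s x<y) = ∸-monoˡ-≤ 1 x<y

mainTheorem5 : (G : Graph) → Connected G →
    (r : Fin (Graph.n G)) (d₁ d₂ : ℕ) → 2 ≤ d₁ → d₁ ≤ d₂ / 2 →
    (u : Fin (Graph.n G)) → AL.White G r d₁ d₂ u →
    (a b du : ℕ) → AL.ConsecutiveBlackLayers G r d₁ d₂ a b →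
    Dist G r u du → a < du → du < b →
    (ρ : ℕ) → AL.WhiteRadius G r d₁ d₂ u ρ → ρ ≤ (b ∸ a) ∸ 2
mainTheorem5 G _ r d₁ d₂ _ _ u _ a b du ((aBlack , _) , _) r↝u a<du du<b
             ρ (ℓ , (_ , nearest) , ρ≡ℓ∸1)
  -- cut a shortest r–u walk, of length a + (du ∸ a), after a steps
  with Walks.splitDist G a (du ∸ a) (subst (Dist G r u) (sym (m+[n∸m]≡n (<⇒≤ a<du))) r↝u)
... | w , r↝w , w↝u = subst (_≤ (b ∸ a) ∸ 2) (sym ρ≡ℓ∸1) (pred-<-∸2 ℓ<b∸a)
  where
  open Walks G using (reverseDist)
  -- w lies in the black layer L_a, and is at distance du ∸ a from u.
  ℓ≤du∸a : ℓ ≤ du ∸ a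
  ℓ≤du∸a = nearest w (du ∸ a) (a , r↝w , aBlack) (reverseDist w↝u)
  ℓ<b∸a : ℓ < b ∸ a
  ℓ<b∸a = ≤-trans (s≤s ℓ≤du∸a) (∸-monoˡ-< du<b (<⇒≤ a<du))
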